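{- Let $n$ and $r$ be positive integers with $n\ge 2r+2$. Then $\rho_2(n+1,r+1)\ge \rho_2(n,r)$.
   Context: For integers $n\ge 2r\ge 2$, the Kneser graph $K(n,r)$ has as vertices the $r$-element subsets of $[n]=\{1,\dots,n\}$, two vertices being adjacent iff they are disjoint. A 2-packing of a graph is a set of vertices that are pairwise at distance at least $3$ (no two adjacent and no two with a common neighbor); $\rho_2(G)$ is the maximum cardinality of a 2-packing, and $\rho_2(n,r)=\rho_2(K(n,r))$. -}

module Defs where

open import Data.Nat using (ℕ; _≤_)
open import Data.Fin using (Fin)
open import Data.Fin.Subset using (Subset; _∈_; ∣_∣)
open import Data.List using (List; length)
open import Data.List.Relation.Unary.All using (All)
open import Data.List.Relation.Unary.AllPairs using (AllPairs)
open import Data.Product using (Σ; _×_)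
open import Relation.Binary.PropositionalEquality using (_≡_; _≢_)
open import Relation.Nullary using (¬_)
open import Data.Empty using (⊥)

-- vertices of the Kneser graph K(n,r): r-element subsets of [n] (Fin n)
IsVertex : (n r : ℕ) → Subset n → Set
IsVertex n r A = ∣ A ∣ ≡ r

-- adjacency in K(n,r): disjointness
Disjoint : {n : ℕ} → Subset n → Subset n → Set
Disjoint {n} A B = (i : Fin n) → i ∈ A → i ∈ B → ⊥

DistGe3 : (n r : ℕ) → Subset n → Subset n → Set
DistGe3 n r A B =
  (A ≢ B) × (¬ Disjoint A B) ×
  ¬ (Σ (Subset n) (λ C → IsVertex n r C × Disjoint A C × Disjoint C B))

IsTwoPacking : (n r : ℕ) → List (Subset n) → Set
IsTwoPacking n r P = All (IsVertex n r) P × AllPairs (DistGe3 n r) P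

-- k is the maximum cardinality of a 2-packing of K(n,r), i.e. k = ρ₂(n,r)
IsRho2 : (n r k : ℕ) → Set
IsRho2 n r k =
  Σ (List (Subset n)) (λ P → IsTwoPacking n r P × length P ≡ k) ×
  ((P : List (Subset n)) → IsTwoPacking n r P → length P ≤ k)

{-# OPTIONS --safe #-}
module Submission where

open import Defs
open import Data.Nat using (ℕ; suc; _+_; _*_; _≤_; pred)
open import Data.Bool using (true; false)
open import Data.Fin using (zero; suc)
open import Data.Fin.Subset using (Subset; ∣_∣; inside; outside; _⊆_)
open import Data.Vec using (_∷_; here; there)
open import Data.List using (List; length; map)
open import Data.List.Properties using (length-map)
import Data.List.Relation.Unary.All as All
import Data.List.Relation.Unary.All.Properties as All
import Data.List.Relation.Unary.AllPairs as AllPairs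
import Data.List.Relation.Unary.AllPairs.Properties as AllPairs
open import Data.Product using (Σ; _×_; _,_)
open import Data.Empty using (⊥)
open import Relation.Binary.PropositionalEquality using (_≡_; refl; cong; trans; subst)

-- Adjoin a new point (index zero) to every set of a 2-packing of K(n,r).  The
-- extended sets are (r+1)-subsets of [n+1] that pairwise meet.  A common
-- neighbour C of two of them avoids the new point, so C is an (r+1)-subset of
-- [n]; any r-subset of C would then be a common neighbour of the original
-- sets.  Hence we get a 2-packing of K(n+1,r+1) of the same size.

withZero : ∀ {n} → Subset n → Subset (suc n)
withZero A = inside ∷ A

withZero-injective : ∀ {n} {A B : Subset n} → withZero A ≡ withZero B → A ≡ B
withZero-injective refl = refl

IsVertex-withZero : ∀ {n r} {A : Subset n} →
  IsVertex n r A → IsVertex (suc n) (suc r) (withZero A)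
IsVertex-withZero = cong suc

⊆-of-size-pred : ∀ {n} r (C : Subset n) → ∣ C ∣ ≡ suc r →
  Σ (Subset n) (λ D → ∣ D ∣ ≡ r × D ⊆ C)
⊆-of-size-pred r (true ∷ C) ∣C∣≡1+r = outside ∷ C , cong pred ∣C∣≡1+r , D⊆C
  where
  D⊆C : outside ∷ C ⊆ inside ∷ C
  D⊆C (there i∈C) = there i∈C
⊆-of-size-pred r (false ∷ C) ∣C∣≡1+r with ⊆-of-size-pred r C ∣C∣≡1+r
... | D , ∣D∣≡r , D⊆C = outside ∷ D , ∣D∣≡r , D∷⊆C∷
  where
  D∷⊆C∷ : outside ∷ D ⊆ outside ∷ C
  D∷⊆C∷ (there i∈D) = there (D⊆C i∈D)

Disjoint-shrink : ∀ {n} {x y} {A A′ B B′ : Subset n} → A ⊆ A′ → B ⊆ B′ →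
  Disjoint (x ∷ A′) (y ∷ B′) → Disjoint A B
Disjoint-shrink A⊆A′ B⊆B′ disj i i∈A i∈B = disj (suc i) (there (A⊆A′ i∈A)) (there (B⊆B′ i∈B))

DistGe3-withZero : ∀ {n r} {A B : Subset n} →
  DistGe3 n r A B → DistGe3 (suc n) (suc r) (withZero A) (withZero B)
DistGe3-withZero {n} {r} {A} {B} (A≢B , A∩B≢∅ , noCommonNbr) =
  (λ eq → A≢B (withZero-injective eq)) , (λ disj → disj zero here here) , noExtCommonNbr
  where
  noExtCommonNbr : Σ (Subset (suc n)) (λ C → IsVertex (suc n) (suc r) C ×
    Disjoint (withZero A) C × Disjoint C (withZero B)) → ⊥
  noExtCommonNbr (true ∷ C , _ , A∩C≡∅ , _) = A∩C≡∅ zero here here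
  noExtCommonNbr (false ∷ C , ∣C∣≡1+r , A∩C≡∅ , C∩B≡∅)
    with ⊆-of-size-pred r C ∣C∣≡1+r
  ... | D , ∣D∣≡r , D⊆C =
    noCommonNbr (D , ∣D∣≡r , Disjoint-shrink (λ i∈A → i∈A) D⊆C A∩C≡∅
                           , Disjoint-shrink D⊆C (λ i∈B → i∈B) C∩B≡∅)

IsTwoPacking-withZero : ∀ {n r} {P : List (Subset n)} →
  IsTwoPacking n r P → IsTwoPacking (suc n) (suc r) (map withZero P)
IsTwoPacking-withZero (vertices , distances) =
  All.map⁺ (All.map (λ {A} → IsVertex-withZero {A = A}) vertices) ,
  AllPairs.map⁺ (AllPairs.map DistGe3-withZero distances)

mainTheorem11 : (n r : ℕ) → 1 ≤ r → 2 * r + 2 ≤ n →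
    (a b : ℕ) → IsRho2 n r a → IsRho2 (suc n) (suc r) b → a ≤ b
mainTheorem11 n r _ _ a b ((P , packing , ∣P∣≡a) , _) (_ , maximal) =
  subst (_≤ b) (trans (length-map withZero P) ∣P∣≡a)
    (maximal (map withZero P) (IsTwoPacking-withZero packing))
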